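{- Let $\lambda\leq\Omega$ be a limit ordinal and let $\mathfrak F'=(f_\eta)_{\eta<\lambda}$ be a sequence of functions with properties (1)–(3) of the context. Then $\lambda<\Omega$.
   Context: $\Omega=\omega_1$. Each $f_\eta$ is a strictly increasing function from the positive integers $\{1,2,3,\dots\}$ to the positive integers; $Vf$ denotes the range of $f$, and $f^2=f\circ f$. For ordinals $\alpha<\beta<\lambda$, write $\alpha\to\beta$ if $Vf_\zeta\subseteq Vf_\alpha$ for all $\zeta$ with $\alpha<\zeta\leq\beta$. Properties, for all $\eta<\lambda$: (1) $f_0(x)=2^x$. (2) If $\eta=\eta'+1$ then $f_\eta=f_{\eta'}^2$. (3) If $\eta$ is a limit ordinal, then $\eta$ is assigned a strictly increasing sequence $(\eta_x)_{x<\omega}$ with supremum $\eta$, such that $\eta_x+1\to\eta_{x+1}$ for all $x<\omega$, and $f_\eta(x)=f_{\eta_x}(1)$ for all $x\geq1$. -}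

module Defs where

open import Data.Nat using (ℕ; suc; _≤_; _<_; _^_)
open import Data.Product using (Σ; _×_; ∃; _,_)
open import Data.Sum using (_⊎_)
open import Relation.Binary.PropositionalEquality using (_≡_)
open import Relation.Binary.Structures using (IsStrictTotalOrder)
open import Induction.WellFounded using (WellFounded)
open import Relation.Nullary using (¬_)

-- An ordinal is represented by its order type: a type with a strict
-- well-ordering (well-founded strict total order, equality = ≡).
record WellOrder : Set₁ where
  field
    Carrier : Set
    _≺_     : Carrier → Carrier → Set
    isSTO   : IsStrictTotalOrder _≡_ _≺_
    wf      : WellFounded _≺_

module _ (W : WellOrder) where
  open WellOrder W

  _≼_ : Carrier → Carrier → Set
  a ≼ b = (a ≺ b) ⊎ (a ≡ b)

  IsZero : Carrier → Set
  IsZero z = ∀ y → ¬ (y ≺ z)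

  IsSucc : Carrier → Carrier → Set
  IsSucc η η' = (η' ≺ η) × (∀ z → η' ≺ z → ¬ (z ≺ η))

  IsLimitElt : Carrier → Set
  IsLimitElt η = (∃ λ y → y ≺ η) × (∀ η' → ¬ IsSucc η η')

  -- the order type λ itself is a limit ordinal: no greatest element
  -- (this includes λ = 0)
  IsLimitOrd : Set
  IsLimitOrd = ∀ x → ∃ λ y → x ≺ y

  -- λ < Ω  ⇔  λ is countable (injects into ℕ)
  CountableOrd : Set
  CountableOrd = Σ (Carrier → ℕ) λ g → ∀ y z → g y ≡ g z → y ≡ z

  -- λ ≤ Ω  ⇔  every proper initial segment of λ is countable
  AtMostΩ : Set
  AtMostΩ = ∀ x → Σ (Carrier → ℕ) λ g →
              ∀ y z → y ≺ x → z ≺ x → g y ≡ g z → y ≡ z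

-- Functions from positive integers to positive integers are represented
-- as f : ℕ → ℕ, where only arguments x ≥ 1 are relevant.
Positive : (ℕ → ℕ) → Set
Positive f = ∀ x → 1 ≤ x → 1 ≤ f x

StrictlyIncreasing : (ℕ → ℕ) → Set
StrictlyIncreasing f = ∀ x y → 1 ≤ x → x < y → f x < f y

InRange : (ℕ → ℕ) → ℕ → Set
InRange f y = ∃ λ x → (1 ≤ x) × (f x ≡ y)

_⊆V_ : (ℕ → ℕ) → (ℕ → ℕ) → Set
f ⊆V g = ∀ y → InRange f y → InRange g y

module _ (W : WellOrder) (F : WellOrder.Carrier W → ℕ → ℕ) where
  open WellOrder W

  Arrow : Carrier → Carrier → Set
  Arrow α β = ∀ ζ → α ≺ ζ → _≼_ W ζ β → F ζ ⊆V F α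

  Prop1 : Set
  Prop1 = ∀ z → IsZero W z → ∀ x → 1 ≤ x → F z x ≡ 2 ^ x

  Prop2 : Set
  Prop2 = ∀ η η' → IsSucc W η η' → ∀ x → 1 ≤ x → F η x ≡ F η' (F η' x)

  FundSeq : Carrier → (ℕ → Carrier) → Set
  FundSeq η s =
      (∀ x → s x ≺ s (suc x))
    × (∀ x → s x ≺ η)
    × (∀ z → z ≺ η → ∃ λ x → z ≺ s x)
    × (∀ x s⁺ → IsSucc W s⁺ (s x) → Arrow s⁺ (s (suc x)))
    × (∀ x → 1 ≤ x → F η x ≡ F (s x) 1)

  Prop3 : Set
  Prop3 = ∀ η → IsLimitElt W η → Σ (ℕ → Carrier) (FundSeq η)

module Submission where

-- For a limit θ with fundamental sequence (θ_x) and σ = θ_x + 1, the arrows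
-- θ_y + 1 → θ_{y+1} chain together, so every ζ in [σ, θ) has V f_ζ ⊆ V f_σ,
-- hence f_ζ(1) ≥ f_σ(1) = f_{θ_x}²(1) ≥ f_{θ_x}(1) = f_θ(x) ≥ x.  Therefore
-- each set {ζ : f_ζ(1) ≤ c} is bounded: otherwise it contains an increasing
-- ω-sequence whose supremum θ (which exists unless some ω-sequence is already
-- cofinal) is a limit, and the terms near θ have f_ζ(1) > c.  Bounds b_c of
-- these sets form a cofinal ω-sequence, since ζ < b_{f_ζ(1)}; as λ ≤ Ω makes
-- every segment [0, b_c) countable, λ is a countable union of countable sets.

open import Defs
open import Level using (0ℓ)
open import Data.Nat using (ℕ; zero; suc; _+_; _≤_; _<_; _≤′_; ≤′-refl; ≤′-step; z≤n; s≤s)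
open import Data.Nat.Properties
open import Data.Product using (Σ; _×_; ∃; _,_; proj₁; proj₂)
open import Data.Product.Properties using (,-injective)
open import Data.Sum using (inj₁; inj₂)
open import Data.Empty using (⊥-elim)
open import Relation.Nullary using (¬_; yes; no)
open import Relation.Binary.PropositionalEquality
open import Relation.Binary.Definitions using (tri<; tri≈; tri>)
open import Relation.Binary.Structures using (IsStrictTotalOrder)
open import Induction.WellFounded using (Acc; acc)
open import Axiom.ExcludedMiddle using (ExcludedMiddle)
open import Axiom.DoubleNegationElimination using (em⇒dne)

-- Enumerate ℕ × ℕ along the anti-diagonals a + b = n, from (0 , n) to (n , 0).
next-pair : ℕ × ℕ → ℕ × ℕ
next-pair (a , suc b) = (suc a , b)
next-pair (a , zero)  = (zero , suc a)

unpair : ℕ → ℕ × ℕ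
unpair zero    = (0 , 0)
unpair (suc n) = next-pair (unpair n)

-- The position of (0 , n), i.e. the number of pairs with a + b < n.
diagonal-start : ℕ → ℕ
diagonal-start zero    = 0
diagonal-start (suc n) = suc (diagonal-start n + n)

pair : ℕ → ℕ → ℕ
pair a b = diagonal-start (a + b) + a

unpair-diagonal : ∀ n a b → a + b ≡ n → unpair (diagonal-start n + a) ≡ (a , b)
unpair-diagonal n (suc a) b eq = begin
  unpair (diagonal-start n + suc a)     ≡⟨ cong unpair (+-suc (diagonal-start n) a) ⟩
  next-pair (unpair (diagonal-start n + a))
    ≡⟨ cong next-pair (unpair-diagonal n a (suc b) (trans (+-suc a b) eq)) ⟩
  (suc a , b)                           ∎
  where open ≡-Reasoning
unpair-diagonal zero    zero zero     refl = refl
unpair-diagonal (suc n) zero (suc .n) refl = begin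
  unpair (diagonal-start (suc n) + 0)   ≡⟨ cong unpair (+-identityʳ (diagonal-start (suc n))) ⟩
  next-pair (unpair (diagonal-start n + n))
    ≡⟨ cong next-pair (unpair-diagonal n n 0 (+-identityʳ n)) ⟩
  (0 , suc n)                           ∎
  where open ≡-Reasoning

pair-injective : ∀ {a b c d} → pair a b ≡ pair c d → a ≡ c × b ≡ d
pair-injective {a} {b} {c} {d} eq = ,-injective (begin
  (a , b)              ≡⟨ sym (unpair-diagonal _ a b refl) ⟩
  unpair (pair a b)    ≡⟨ cong unpair eq ⟩
  unpair (pair c d)    ≡⟨ unpair-diagonal _ c d refl ⟩
  (c , d)              ∎)
  where open ≡-Reasoning

inflationary : ∀ {f} → Positive f → StrictlyIncreasing f → ∀ x → 1 ≤ x → x ≤ f x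
inflationary pos inc (suc zero)    1≤x = pos 1 1≤x
inflationary pos inc (suc (suc x)) _   =
  ≤-trans (s≤s (inflationary pos inc (suc x) (s≤s z≤n))) (inc (suc x) (suc (suc x)) (s≤s z≤n) ≤-refl)

range-above-f1 : ∀ {f y} → StrictlyIncreasing f → InRange f y → f 1 ≤ y
range-above-f1 inc (suc zero , _ , refl)    = ≤-refl
range-above-f1 inc (suc (suc x) , _ , refl) = <⇒≤ (inc 1 (suc (suc x)) ≤-refl (s≤s (s≤s z≤n)))

square-range : ∀ {f g} → Positive f → (∀ x → 1 ≤ x → g x ≡ f (f x)) → g ⊆V f
square-range {f} pos g≡f² y (x , 1≤x , gx≡y) = f x , pos x 1≤x , trans (sym (g≡f² x 1≤x)) gx≡y

⊆V-trans : ∀ {f g h} → f ⊆V g → g ⊆V h → f ⊆V h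
⊆V-trans f⊆g g⊆h y y∈f = g⊆h y (f⊆g y y∈f)

module Order (W : WellOrder) where
  open WellOrder W public
  open IsStrictTotalOrder isSTO public using (compare) renaming (trans to ≺-trans)

  _⊑_ : Carrier → Carrier → Set
  a ⊑ b = _≼_ W a b

  ≮⇒⊒ : ∀ {a b} → ¬ a ≺ b → b ⊑ a
  ≮⇒⊒ {a} {b} a≮b with compare a b
  ... | tri< a<b _ _ = ⊥-elim (a≮b a<b)
  ... | tri≈ _ a≡b _ = inj₂ (sym a≡b)
  ... | tri> _ _ b<a = inj₁ b<a

  ⊑-≺-trans : ∀ {a b c} → a ⊑ b → b ≺ c → a ≺ c
  ⊑-≺-trans (inj₁ a<b) b<c = ≺-trans a<b b<c
  ⊑-≺-trans (inj₂ refl) b<c = b<c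

  ≺-⊑-trans : ∀ {a b c} → a ≺ b → b ⊑ c → a ≺ c
  ≺-⊑-trans a<b (inj₁ b<c) = ≺-trans a<b b<c
  ≺-⊑-trans a<b (inj₂ refl) = a<b

  ⊑-trans : ∀ {a b c} → a ⊑ b → b ⊑ c → a ⊑ c
  ⊑-trans a⊑b (inj₁ b<c)  = inj₁ (⊑-≺-trans a⊑b b<c)
  ⊑-trans a⊑b (inj₂ refl) = a⊑b

  increasing-mono : (s : ℕ → Carrier) → (∀ n → s n ≺ s (suc n)) → ∀ {m n} → m ≤ n → s m ⊑ s n
  increasing-mono s s-inc m≤n = go (≤⇒≤′ m≤n)
    where
    go : ∀ {m n} → m ≤′ n → s m ⊑ s n
    go ≤′-refl = inj₂ refl
    go (≤′-step m≤′n) = inj₁ (⊑-≺-trans (go m≤′n) (s-inc _))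

  Cofinal : (ℕ → Carrier) → Set
  Cofinal s = ∀ z → ∃ λ n → z ≺ s n

  -- Countably many countable initial segments exhaust an order with a
  -- cofinal ω-sequence, so such an order is countable when λ ≤ Ω.
  countable-of-cofinal : AtMostΩ W → Σ (ℕ → Carrier) Cofinal → CountableOrd W
  countable-of-cofinal segment-countable (s , cofinal) = code , code-injective
    where
    local : ℕ → Carrier → ℕ
    local n = proj₁ (segment-countable (s n))

    index : Carrier → ℕ
    index z = proj₁ (cofinal z)

    code : Carrier → ℕ
    code z = pair (index z) (local (index z) z)

    injective-on-segments : ∀ {m n y z} → y ≺ s m → z ≺ s n →
                            pair m (local m y) ≡ pair n (local n z) → y ≡ z
    injective-on-segments {m} {n} {y} {z} y<sm z<sn eq with pair-injective {m} {local m y} {n} {local n z} eq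
    ... | refl , same-local = proj₂ (segment-countable (s _)) _ _ y<sm z<sn same-local

    code-injective : ∀ y z → code y ≡ code z → y ≡ z
    code-injective y z = injective-on-segments (proj₂ (cofinal y)) (proj₂ (cofinal z))

module ClassicalOrder (em : ExcludedMiddle 0ℓ) (W : WellOrder) where
  open Order W public

  dne : {P : Set} → ¬ ¬ P → P
  dne = em⇒dne em

  ¬∀⇒∃¬ : {A : Set} {P : A → Set} → ¬ (∀ a → P a) → ∃ λ a → ¬ P a
  ¬∀⇒∃¬ ¬∀ = dne λ ¬∃ → ¬∀ λ a → dne λ ¬Pa → ¬∃ (a , ¬Pa)

  least : (P : Carrier → Set) → ∀ a → P a → Σ Carrier λ m → P m × (∀ y → P y → ¬ y ≺ m)
  least P a = go a (wf a)
    where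
    go : ∀ a → Acc _≺_ a → P a → Σ Carrier λ m → P m × (∀ y → P y → ¬ y ≺ m)
    go a (acc below) Pa with em {∃ λ y → y ≺ a × P y}
    ... | yes (y , y<a , Py) = go y (below y<a) Py
    ... | no  ¬smaller       = a , Pa , λ y Py y<a → ¬smaller (y , y<a , Py)

  successor : ∀ {a b} → a ≺ b → Σ Carrier λ σ → IsSucc W σ a
  successor {a} {b} a<b with least (a ≺_) b a<b
  ... | σ , a<σ , minimal = σ , a<σ , minimal

  Supremum : (ℕ → Carrier) → Carrier → Set
  Supremum s θ = (∀ n → s n ≺ θ) × (∀ u → u ≺ θ → ∃ λ n → u ≺ s n)

  supremum : ∀ s → (∀ n → s n ≺ s (suc n)) → ¬ Cofinal s →
             Σ Carrier λ θ → Supremum s θ × IsLimitElt W θ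
  supremum s s-inc ¬cof = θ , (θ-bound , θ-least) , θ-limit
    where
    UpperBound : Carrier → Set
    UpperBound u = ∀ n → s n ≺ u

    some-bound : Σ Carrier UpperBound
    some-bound with ¬∀⇒∃¬ ¬cof
    ... | z , ¬below = z , λ n → ≺-⊑-trans (s-inc n) (≮⇒⊒ λ z<s → ¬below (suc n , z<s))

    lub : Σ Carrier λ m → UpperBound m × (∀ y → UpperBound y → ¬ y ≺ m)
    lub = least UpperBound (proj₁ some-bound) (proj₂ some-bound)

    θ : Carrier
    θ = proj₁ lub

    θ-bound : UpperBound θ
    θ-bound = proj₁ (proj₂ lub)

    θ-least : ∀ u → u ≺ θ → ∃ λ n → u ≺ s n
    θ-least u u<θ with ¬∀⇒∃¬ (λ u-bound → proj₂ (proj₂ lub) u u-bound u<θ)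
    ... | n , s≮u = suc n , ⊑-≺-trans (≮⇒⊒ s≮u) (s-inc n)

    -- A predecessor δ of θ would lie below some s n, hence s n would lie in (δ, θ).
    θ-limit : IsLimitElt W θ
    θ-limit = (s 0 , θ-bound 0) , λ δ δ-pred →
      let (n , δ<s) = θ-least δ (proj₁ δ-pred) in proj₂ δ-pred (s n) δ<s (θ-bound n)

  Bounded : (Carrier → Set) → Set
  Bounded P = Σ Carrier λ b → ∀ ζ → P ζ → ζ ≺ b

  increasing-sequence : IsLimitOrd W → Carrier → (P : Carrier → Set) → ¬ Bounded P →
    Σ (ℕ → Carrier) λ s → (∀ n → P (s n)) × (∀ n → s n ≺ s (suc n))
  increasing-sequence no-max start P unbounded = term , (λ n → proj₂ (chain n)) , λ n → proj₂ (proj₂ (above (term n)))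
    where
    above : ∀ u → Σ Carrier λ ζ → P ζ × u ≺ ζ
    above u with no-max u
    ... | v , u<v with ¬∀⇒∃¬ (λ bound → unbounded (v , bound))
    ...   | ζ , ¬[Pζ→ζ<v] = ζ , dne (λ ¬Pζ → ¬[Pζ→ζ<v] λ Pζ → ⊥-elim (¬Pζ Pζ))
                          , ≺-⊑-trans u<v (≮⇒⊒ λ ζ<v → ¬[Pζ→ζ<v] λ _ → ζ<v)

    pick-above : Carrier → Σ Carrier P
    pick-above u = proj₁ (above u) , proj₁ (proj₂ (above u))

    chain : ℕ → Σ Carrier P
    chain zero    = pick-above start
    chain (suc n) = pick-above (proj₁ (chain n))

    term : ℕ → Carrier
    term n = proj₁ (chain n)

module Hierarchy (em : ExcludedMiddle 0ℓ) (W : WellOrder) (F : WellOrder.Carrier W → ℕ → ℕ)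
  (pos : ∀ η → Positive (F η)) (inc : ∀ η → StrictlyIncreasing (F η))
  (prop2 : Prop2 W F) (prop3 : Prop3 W F) where
  open ClassicalOrder em W

  successor-range : ∀ {η η'} → IsSucc W η η' → F η ⊆V F η'
  successor-range η=η'+1 = square-range (pos _) (prop2 _ _ η=η'+1)

  arrow-closed : ∀ {α β ζ} → Arrow W F α β → α ⊑ ζ → ζ ⊑ β → F ζ ⊆V F α
  arrow-closed α→β (inj₁ α<ζ) ζ⊑β = α→β _ α<ζ ζ⊑β
  arrow-closed α→β (inj₂ refl) _  = λ y y∈Vf → y∈Vf

  module Limit {θ : Carrier} {s : ℕ → Carrier} (fs : FundSeq W F θ s) where
    s-inc : ∀ x → s x ≺ s (suc x)
    s-inc = proj₁ fs

    s-below : ∀ x → s x ≺ θ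
    s-below = proj₁ (proj₂ fs)

    s-cofinal : ∀ z → z ≺ θ → ∃ λ x → z ≺ s x
    s-cofinal = proj₁ (proj₂ (proj₂ fs))

    s-arrow : ∀ x σ → IsSucc W σ (s x) → Arrow W F σ (s (suc x))
    s-arrow = proj₁ (proj₂ (proj₂ (proj₂ fs)))

    s-value : ∀ x → 1 ≤ x → F θ x ≡ F (s x) 1
    s-value = proj₂ (proj₂ (proj₂ (proj₂ fs)))

    successor-below-next : ∀ {x σ} → IsSucc W σ (s x) → σ ⊑ s (suc x)
    successor-below-next σ-succ = ≮⇒⊒ (proj₂ σ-succ _ (s-inc _))

    -- Chaining the arrows θ_y + 1 → θ_{y+1} for y ≥ x: with σ = θ_x + 1,
    -- every ζ in [σ, θ_{x+1+k}] has V f_ζ ⊆ V f_σ.  In the inductive step,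
    -- ζ beyond θ_{x+1+k} lies in [σ', θ_{x+2+k}] for σ' = θ_{x+1+k} + 1, and
    -- V f_ζ ⊆ V f_σ' ⊆ V f_{θ_{x+1+k}} ⊆ V f_σ.
    chained-arrows : ∀ {x σ} → IsSucc W σ (s x) →
                     ∀ k {ζ} → σ ⊑ ζ → ζ ⊑ s (k + suc x) → F ζ ⊆V F σ
    chained-arrows σ-succ zero σ⊑ζ ζ⊑ = arrow-closed (s-arrow _ _ σ-succ) σ⊑ζ ζ⊑
    chained-arrows {x} {σ} σ-succ (suc k) {ζ} σ⊑ζ ζ⊑ with compare (s (k + suc x)) ζ
    ... | tri≈ _ s≡ζ _ = chained-arrows σ-succ k σ⊑ζ (inj₂ (sym s≡ζ))
    ... | tri> _ _ ζ<s = chained-arrows σ-succ k σ⊑ζ (inj₁ ζ<s)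
    ... | tri< s<ζ _ _ with successor (s-inc (k + suc x))
    ...   | σ' , σ'-succ =
      ⊆V-trans (arrow-closed (s-arrow _ _ σ'-succ) (≮⇒⊒ (proj₂ σ'-succ ζ s<ζ)) ζ⊑)
     (⊆V-trans (successor-range σ'-succ)
               (chained-arrows σ-succ k σ⊑s (inj₂ refl)))
      where
      σ⊑s : σ ⊑ s (k + suc x)
      σ⊑s = ⊑-trans (successor-below-next σ-succ) (increasing-mono s s-inc (m≤n+m (suc x) k))

    value-below-limit : ∀ {x σ} → IsSucc W σ (s x) → ∀ {ζ} → σ ⊑ ζ → ζ ≺ θ → F σ 1 ≤ F ζ 1
    value-below-limit {x} σ-succ {ζ} σ⊑ζ ζ<θ with s-cofinal _ ζ<θ
    ... | y , ζ<sy = range-above-f1 (inc _) (chained-arrows σ-succ y σ⊑ζ ζ⊑ _ (1 , ≤-refl , refl))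
      where
      ζ⊑ : ζ ⊑ s (y + suc x)
      ζ⊑ = inj₁ (≺-⊑-trans ζ<sy (increasing-mono s s-inc (m≤m+n y (suc x))))

    successor-value : ∀ {x σ} → 1 ≤ x → IsSucc W σ (s x) → x ≤ F σ 1
    successor-value {x} {σ} 1≤x σ-succ = begin
      x                     ≤⟨ inflationary (pos θ) (inc θ) x 1≤x ⟩
      F θ x                 ≡⟨ s-value x 1≤x ⟩
      F (s x) 1             ≤⟨ inflationary (pos (s x)) (inc (s x)) _ (pos (s x) 1 ≤-refl) ⟩
      F (s x) (F (s x) 1)   ≡⟨ sym (prop2 σ (s x) σ-succ 1 ≤-refl) ⟩
      F σ 1                 ∎
      where open ≤-Reasoning

  large-below-limit : ∀ {θ} → IsLimitElt W θ → ∀ c →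
                      Σ Carrier λ σ → σ ≺ θ × (∀ ζ → σ ⊑ ζ → ζ ≺ θ → c < F ζ 1)
  large-below-limit {θ} θ-limit c with prop3 _ θ-limit
  ... | s , fs with successor (proj₁ fs (suc c))
  ...   | σ , σ-succ = σ , ⊑-≺-trans (successor-below-next σ-succ) (s-below _) , large
    where
    open Limit fs
    large : ∀ ζ → σ ⊑ ζ → ζ ≺ θ → suc c ≤ F ζ 1
    large ζ σ⊑ζ ζ<θ = ≤-trans (successor-value (s≤s z≤n) σ-succ) (value-below-limit σ-succ σ⊑ζ ζ<θ)

  Small : ℕ → Carrier → Set
  Small c ζ = F ζ 1 ≤ c

  -- Unless some ω-sequence is cofinal, each set of small ordinals is bounded:
  -- otherwise it contains an increasing sequence whose supremum θ is a limit,
  -- and the terms near θ are not small.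
  small-bounded : IsLimitOrd W → Carrier → (∀ s → ¬ Cofinal s) → ∀ c → Bounded (Small c)
  small-bounded no-max start ¬cofinal c = dne λ unbounded →
    let (t , t-small , t-inc)           = increasing-sequence no-max start (Small c) unbounded
        (θ , (t<θ , θ-least) , θ-limit) = supremum t t-inc (¬cofinal t)
        (σ , σ<θ , large)               = large-below-limit θ-limit c
        (n , σ<tn)                      = θ-least σ σ<θ
    in <⇒≱ (large (t n) (inj₁ σ<tn) (t<θ n)) (t-small n)

  -- Bounds b_c of the small sets form a cofinal ω-sequence, as ζ < b_{f_ζ(1)}.
  cofinal-sequence : IsLimitOrd W → Carrier → Σ (ℕ → Carrier) Cofinal
  cofinal-sequence no-max start with em {Σ (ℕ → Carrier) Cofinal}
  ... | yes cofinal = cofinal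
  ... | no ¬cofinal = (λ c → proj₁ (bounded c)) , λ ζ → F ζ 1 , proj₂ (bounded (F ζ 1)) ζ ≤-refl
    where
    bounded : ∀ c → Bounded (Small c)
    bounded = small-bounded no-max start λ s cofinal → ¬cofinal (s , cofinal)

-- The theorem: λ < Ω.

theorem2 : ExcludedMiddle 0ℓ → (W : WellOrder) → IsLimitOrd W → AtMostΩ W →
    (F : WellOrder.Carrier W → ℕ → ℕ) →
    (∀ η → Positive (F η)) → (∀ η → StrictlyIncreasing (F η)) →
    Prop1 W F → Prop2 W F → Prop3 W F → CountableOrd W
theorem2 em W no-max segment-countable F pos inc _ prop2 prop3 with em {WellOrder.Carrier W}
... | no empty    = (λ z → ⊥-elim (empty z)) , λ y → ⊥-elim (empty y)
... | yes start   = Order.countable-of-cofinal W segment-countable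
                      (Hierarchy.cofinal-sequence em W F pos inc prop2 prop3 no-max start)
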